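{- The CNF $\mathrm{Bin}\text{ - }\mathrm{OP}_n$ has Resolution refutations of size polynomial in $n$.
   Context: $n$ is a power of 2; for $a\in[n]$, $a_1\dots a_{\log n}$ is its binary representation, and $\omega^1=\omega$, $\omega^0=\neg\omega$. $\mathrm{Bin}\text{ - }\mathrm{OP}_n$ (the binary encoding of the negation of the ordering principle "every finite partial order has a maximal element") has variables $\nu_{x,y}$ ($x,y\in[n]$) and $\omega_{x,i}$ ($x\in[n]$, $i\in[\log n]$), and clauses: $\neg\nu_{x,x}$ for $x\in[n]$; $\neg\nu_{x,y}\vee\neg\nu_{y,z}\vee\nu_{x,z}$ for $x,y,z\in[n]$; and $\bigvee_{i\in[\log n]}\omega_{x,i}^{1-a_i}\vee\nu_{x,a}$ for all $x,a\in[n]$. -}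

module Defs where

open import Data.Nat using (ℕ; zero; suc; _^_; _%_; _/_; _≡ᵇ_)
open import Data.Bool using (Bool; true; false)
open import Data.Fin using (Fin; toℕ)
open import Data.Vec using (Vec; []; _∷_; lookup)
open import Data.List using (List; []; _∷_; _++_; map; concatMap; allFin)
open import Data.List.Membership.Propositional using (_∈_)
open import Data.Product using (_×_)
open import Data.Sum using (_⊎_)
open import Relation.Binary.PropositionalEquality using (_≢_)
open import Function.Bundles using (_⇔_)

data Literal (V : Set) : Set where
  pos : V → Literal V
  neg : V → Literal V

Clause : Set → Set
Clause V = List (Literal V)      -- a disjunction; read as a set of literals

CNF : Set → Set
CNF V = List (Clause V)

IsResolvent : {V : Set} → V → Clause V → Clause V → Clause V → Set
IsResolvent v C D E =
  ∀ l → (l ∈ E) ⇔ ((l ∈ C × l ≢ pos v) ⊎ (l ∈ D × l ≢ neg v))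

-- A Resolution derivation from F, written as a list of clauses with the
-- most recently derived clause first.  Each clause is either an axiom of F
-- or the resolvent of two earlier clauses.
data Derivation {V : Set} (F : CNF V) : List (Clause V) → Set where
  [] : Derivation F []
  axiom : ∀ {Γ C} → C ∈ F → Derivation F Γ → Derivation F (C ∷ Γ)
  resolve : ∀ {Γ C D E} (v : V) → C ∈ Γ → D ∈ Γ →
            pos v ∈ C → neg v ∈ D → IsResolvent v C D E →
            Derivation F Γ → Derivation F (E ∷ Γ)

-- A Resolution refutation: a derivation containing the empty clause.
-- Its size is the number of clauses (length of the list).
Refutation : {V : Set} → CNF V → List (Clause V) → Set
Refutation F Γ = Derivation F Γ × ([] ∈ Γ)

-- Bin-OP_n for n = 2 ^ m  (so log n = m); [n] is Fin n = {0,…,n-1}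

-- binary representation with m bits, least significant bit first
bits : (m : ℕ) → ℕ → Vec Bool m
bits zero    _ = []
bits (suc m) a = (a % 2 ≡ᵇ 1) ∷ bits m (a / 2)

data BinOPVar (m : ℕ) : Set where
  ν : Fin (2 ^ m) → Fin (2 ^ m) → BinOPVar m
  ω : Fin (2 ^ m) → Fin m → BinOPVar m

-- the literal ω_{x,i}^{1-a_i}:  ω^1 = ω, ω^0 = ¬ω
ωlit : {m : ℕ} → Fin (2 ^ m) → Fin m → Bool → Literal (BinOPVar m)
ωlit x i true  = neg (ω x i)
ωlit x i false = pos (ω x i)

BinOP : (m : ℕ) → CNF (BinOPVar m)
BinOP m =
     map (λ x → neg (ν x x) ∷ []) X
  ++ concatMap (λ x → concatMap (λ y → map (λ z →
        neg (ν x y) ∷ neg (ν y z) ∷ pos (ν x z) ∷ []) X) X) X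
  ++ concatMap (λ x → map (λ a →
        map (λ i → ωlit x i (lookup (bits m (toℕ a)) i)) (allFin m)
          ++ (pos (ν x a) ∷ [])) X) X
  where
    X = allFin (2 ^ m)

-- For each x, the n axioms ω-encoding "x has a successor a" are resolved
-- along a complete binary tree over the bits ω_{x,i}, leaving the unary
-- clause ⋁_y ν_{x,y} after 2n - 1 clauses.  The standard refutation of the
-- ordering principle then removes the elements one by one: if every x ∈ K ∷ S
-- has a clause ⋁_{y ∈ K ∷ S} ν_{x,y}, resolving the one for K with ¬ν_{K,K}
-- gives ⋁_{y ∈ S} ν_{K,y}, and for x ∈ S the literal ν_{x,K} is traded for
-- these via the transitivity axioms ¬ν_{x,K} ∨ ¬ν_{K,y} ∨ ν_{x,y}, using
-- O(|S|²) clauses.  Removing the last element yields the empty clause, after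
-- O(n³) clauses in total.
module Submission where

open import Defs
open import Level using (0ℓ)
open import Data.Bool using (Bool; true; false)
open import Data.Nat using (ℕ; zero; suc; _+_; _*_; _^_; _≤_; _<_; z≤n; s≤s; _%_; _/_; _≡ᵇ_)
open import Data.Nat.Properties
  using (≤-trans; ≤-reflexive; n≤1+n; m≤m+n; +-comm; +-assoc; +-suc; +-identityʳ;
         +-mono-≤; +-monoˡ-≤; +-monoʳ-≤; *-comm; *-mono-≤; *-monoˡ-≤; *-monoʳ-≤; m^n>0;
         module ≤-Reasoning)
open import Data.Nat.DivMod using (m*n%n≡0; m*n/n≡m; [m+kn]%n≡m%n; +-distrib-/-∣ʳ)
open import Data.Nat.Divisibility using (divides-refl)
open import Data.Nat.Tactic.RingSolver using (solve-∀)
open import Data.Fin using (Fin; toℕ; fromℕ<)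
import Data.Fin as Fin
open import Data.Fin.Properties using (toℕ-fromℕ<)
open import Data.Vec using (Vec; []; _∷_; lookup)
open import Data.List using (List; []; _∷_; _++_; length; map; concatMap; filter; allFin)
open import Data.List.Properties using (length-tabulate)
open import Data.List.Membership.Propositional using (_∈_; lose)
open import Data.List.Membership.Propositional.Properties
  using (∈-++⁺ˡ; ∈-++⁺ʳ; ∈-++⁻; ∈-map⁺; ∈-map⁻; ∈-concatMap⁺; ∈-filter⁺; ∈-filter⁻; ∈-allFin)
import Data.List.Membership.DecPropositional as DecMembership
open import Data.List.Relation.Binary.Subset.Propositional renaming (_⊆_ to _⊑_)
open import Data.List.Relation.Binary.Subset.Propositional.Properties
  renaming (⊆-refl to ⊑-refl; ⊆-trans to ⊑-trans)
open import Data.List.Relation.Unary.Any using (here; there)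
open import Data.Product using (Σ; ∃-syntax; _×_; _,_; proj₁; uncurry)
open import Data.Sum using (_⊎_; inj₁; inj₂; [_,_]; assocˡ)
open import Data.Empty using (⊥-elim)
open import Function using (_∘_; id)
open import Function.Bundles using (mk⇔)
open import Relation.Nullary using (yes; no; ¬?; _×-dec_)
open import Relation.Nullary.Decidable using (map′)
open import Relation.Binary.Definitions using (DecidableEquality)
open import Relation.Binary.PropositionalEquality using (_≡_; _≢_; refl; sym; trans; cong; cong₂)
open import Relation.Unary using (Pred; _⊆_; _∪_; _∖_; ｛_｝; ∅)

literal-≟ : {V : Set} → DecidableEquality V → DecidableEquality (Literal V)
literal-≟ _≟_ (pos u) (pos v) = map′ (cong pos) (λ { refl → refl }) (u ≟ v)
literal-≟ _≟_ (neg u) (neg v) = map′ (cong neg) (λ { refl → refl }) (u ≟ v)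
literal-≟ _ (pos _) (neg _) = no λ ()
literal-≟ _ (neg _) (pos _) = no λ ()

falsified : {V : Set} → Bool → V → Literal V
falsified true  v = neg v
falsified false v = pos v

treeSize : ℕ → ℕ
treeSize zero    = 1
treeSize (suc k) = treeSize k + (treeSize k + 1)

suc-treeSize : ∀ k → suc (treeSize k) ≡ 2 ^ suc k
suc-treeSize zero    = refl
suc-treeSize (suc k) = trans (cong (λ t → suc (treeSize k + t)) (+-suc (treeSize k) 0))
                             (cong (2 *_) (suc-treeSize k))

removalCost : ℕ → ℕ
removalCost s = 2 + s * (s * 3)

refutationCost : ℕ → ℕ
refutationCost zero    = 0
refutationCost (suc s) = removalCost s + refutationCost s

removalCost-mono : ∀ {s t} → s ≤ t → removalCost s ≤ removalCost t
removalCost-mono s≤t = +-monoʳ-≤ 2 (*-mono-≤ s≤t (*-monoˡ-≤ 3 s≤t))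

refutationCost-≤ : ∀ n → refutationCost n ≤ n * removalCost n
refutationCost-≤ zero    = z≤n
refutationCost-≤ (suc s) =
  +-mono-≤ (removalCost-mono (n≤1+n s))
           (≤-trans (refutationCost-≤ s) (*-monoʳ-≤ s (removalCost-mono (n≤1+n s))))

-- The last summand is 7 (1 + p)³ minus the others, added on the left to avoid subtraction.
cubic-identity : ∀ p → (1 + p) * (2 * (1 + p)) + (1 + p) * (2 + (1 + p) * ((1 + p) * 3))
                       + p * (p * (p * 4) + p * 10 + 6)
                     ≡ 7 * ((1 + p) * ((1 + p) * ((1 + p) * 1)))
cubic-identity = solve-∀

cubic-bound : ∀ n → 0 < n → n * (2 * n) + n * removalCost n ≤ 7 * n ^ 3
cubic-bound (suc p) _ = ≤-trans (m≤m+n _ _) (≤-reflexive (cubic-identity p))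

module Resolution {V : Set} (_≟_ : DecidableEquality V) (F : CNF V) where

  open DecMembership (literal-≟ _≟_) using (_∈?_)

  LiteralSet : Set₁
  LiteralSet = Pred (Literal V) 0ℓ

  Subsumes : List (Clause V) → LiteralSet → Set
  Subsumes Γ S = ∃[ C ] C ∈ Γ × (_∈ C) ⊆ S

  Subsumes-mono : ∀ {Γ Δ S} → Γ ⊑ Δ → Subsumes Γ S → Subsumes Δ S
  Subsumes-mono Γ⊑Δ (C , C∈Γ , C⊆S) = C , Γ⊑Δ C∈Γ , C⊆S

  Subsumes-weaken : ∀ {Γ S T} → S ⊆ T → Subsumes Γ S → Subsumes Γ T
  Subsumes-weaken S⊆T (C , C∈Γ , C⊆S) = C , C∈Γ , S⊆T ∘ C⊆S

  empty-clause : ∀ {Γ} → Subsumes Γ ∅ → [] ∈ Γ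
  empty-clause ([]    , []∈Γ , _)   = []∈Γ
  empty-clause (_ ∷ _ , _    , C⊆∅) with C⊆∅ (here refl)
  ... | ()

  Positive : {A : Set} → (A → V) → List A → LiteralSet
  Positive p ys l = ∃[ y ] y ∈ ys × l ≡ pos (p y)

  Falsified : ∀ {k} → (Fin k → V) → Vec Bool k → LiteralSet
  Falsified w []      = ∅
  Falsified w (b ∷ ρ) = ｛ falsified b (w Fin.zero) ｝ ∪ Falsified (w ∘ Fin.suc) ρ

  Falsified-lookup : ∀ {k} (w : Fin k → V) ρ i → Falsified w ρ (falsified (lookup ρ i) (w i))
  Falsified-lookup w (b ∷ ρ) Fin.zero    = inj₁ refl
  Falsified-lookup w (b ∷ ρ) (Fin.suc i) = inj₂ (Falsified-lookup (w ∘ Fin.suc) ρ i)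

  resolvent : V → Clause V → Clause V → Clause V
  resolvent v C D = filter (λ l → ¬? (literal-≟ _≟_ l (pos v))) C
                 ++ filter (λ l → ¬? (literal-≟ _≟_ l (neg v))) D

  resolvent-isResolvent : ∀ v C D → IsResolvent v C D (resolvent v C D)
  resolvent-isResolvent v C D l = mk⇔ to from
    where
    to : l ∈ resolvent v C D → (l ∈ C × l ≢ pos v) ⊎ (l ∈ D × l ≢ neg v)
    to l∈E with ∈-++⁻ (filter _ C) l∈E
    ... | inj₁ l∈C′ = inj₁ (∈-filter⁻ _ l∈C′)
    ... | inj₂ l∈D′ = inj₂ (∈-filter⁻ _ l∈D′)
    from : (l ∈ C × l ≢ pos v) ⊎ (l ∈ D × l ≢ neg v) → l ∈ resolvent v C D
    from (inj₁ (l∈C , l≢v))  = ∈-++⁺ˡ (∈-filter⁺ _ l∈C l≢v)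
    from (inj₂ (l∈D , l≢¬v)) = ∈-++⁺ʳ (filter _ C) (∈-filter⁺ _ l∈D l≢¬v)

  record Extension (Γ : List (Clause V)) (b : ℕ) (P : List (Clause V) → Set) : Set where
    constructor extension
    field
      {Δ}        : List (Clause V)
      derivation : Derivation F Δ
      extends    : Γ ⊑ Δ
      bounded    : length Δ ≤ length Γ + b
      holds      : P Δ

  stay : ∀ {Γ P} → Derivation F Γ → P Γ → Extension Γ 0 P
  stay d p = extension d ⊑-refl (≤-reflexive (sym (+-identityʳ _))) p

  infixl 1 _>>=_
  _>>=_ : ∀ {Γ b b′ P Q} → Extension Γ b P →
          (∀ {Δ} → Γ ⊑ Δ → Derivation F Δ → P Δ → Extension Δ b′ Q) → Extension Γ (b + b′) Q
  _>>=_ {Γ} {b} {b′} (extension d Γ⊑Δ len p) k with k Γ⊑Δ d p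
  ... | extension d′ Δ⊑Δ′ len′ q =
    extension d′ (⊑-trans Γ⊑Δ Δ⊑Δ′)
      (≤-trans len′ (≤-trans (+-monoˡ-≤ b′ len) (≤-reflexive (+-assoc (length Γ) b b′)))) q

  weaken-bound : ∀ {Γ b b′ P} → b ≤ b′ → Extension Γ b P → Extension Γ b′ P
  weaken-bound b≤b′ (extension d Γ⊑Δ len p) = extension d Γ⊑Δ (≤-trans len (+-monoʳ-≤ _ b≤b′)) p

  map-property : ∀ {Γ b P Q} → (∀ {Δ} → Γ ⊑ Δ → P Δ → Q Δ) → Extension Γ b P → Extension Γ b Q
  map-property f (extension d Γ⊑Δ len p) = extension d Γ⊑Δ len (f Γ⊑Δ p)

  axiom-step : ∀ {Γ C} → C ∈ F → Derivation F Γ → Extension Γ 1 (λ Δ → Subsumes Δ (_∈ C))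
  axiom-step {Γ} C∈F d =
    extension (axiom C∈F d) there (≤-reflexive (+-comm 1 (length Γ))) (_ , here refl , λ l∈C → l∈C)

  -- When the pivot is missing from one premise, that premise already subsumes T.
  resolve-step : ∀ {Γ S₁ S₂ T} v → (S₁ ∖ ｛ pos v ｝) ∪ (S₂ ∖ ｛ neg v ｝) ⊆ T →
                 Subsumes Γ S₁ → Subsumes Γ S₂ → Derivation F Γ → Extension Γ 1 (λ Δ → Subsumes Δ T)
  resolve-step {Γ} {S₁} {S₂} v sound (C , C∈Γ , C⊆S₁) (D , D∈Γ , D⊆S₂) d
    with pos v ∈? C | neg v ∈? D
  ... | no v∉C | _ =
    weaken-bound z≤n (stay d (C , C∈Γ , λ l∈C → sound (inj₁ (C⊆S₁ l∈C , λ { refl → v∉C l∈C }))))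
  ... | yes _ | no ¬v∉D =
    weaken-bound z≤n (stay d (D , D∈Γ , λ l∈D → sound (inj₂ (D⊆S₂ l∈D , λ { refl → ¬v∉D l∈D }))))
  ... | yes v∈C | yes ¬v∈D =
    extension (resolve v C∈Γ D∈Γ v∈C ¬v∈D (resolvent-isResolvent v C D) d) there
      (≤-reflexive (+-comm 1 (length Γ))) (resolvent v C D , here refl , sound ∘ premises)
    where
    premises : (_∈ resolvent v C D) ⊆ (S₁ ∖ ｛ pos v ｝) ∪ (S₂ ∖ ｛ neg v ｝)
    premises {l} l∈E with Function.Bundles.Equivalence.to (resolvent-isResolvent v C D l) l∈E
    ... | inj₁ (l∈C , l≢v)  = inj₁ (C⊆S₁ l∈C , l≢v ∘ sym)
    ... | inj₂ (l∈D , l≢¬v) = inj₂ (D⊆S₂ l∈D , l≢¬v ∘ sym)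

  forEach : ∀ {A : Set} {P : A → List (Clause V) → Set} {Γ c} →
            (∀ {x Δ Δ′} → Δ ⊑ Δ′ → P x Δ → P x Δ′) → (xs : List A) →
            (∀ {x} → x ∈ xs → ∀ {Δ} → Γ ⊑ Δ → Derivation F Δ → Extension Δ c (P x)) →
            Derivation F Γ → Extension Γ (length xs * c) (λ Δ → ∀ {x} → x ∈ xs → P x Δ)
  forEach mono []       step d = stay d λ ()
  forEach mono (x ∷ xs) step d =
    step (here refl) ⊑-refl d >>= λ Γ⊑Δ dΔ px →
    map-property (λ Δ⊑Δ′ pxs → λ { (here refl) → mono Δ⊑Δ′ px ; (there x∈xs) → pxs x∈xs })
      (forEach mono xs (λ x∈xs Δ⊑Δ′ → step (there x∈xs) (⊑-trans Γ⊑Δ Δ⊑Δ′)) dΔ)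

  resolve-along : ∀ {A : Set} (p : A → V) {T Γ c} (ys : List A) →
                  (∀ {y} → y ∈ ys → ∀ {Δ} → Γ ⊑ Δ → Derivation F Δ →
                     Extension Δ c (λ Δ′ → Subsumes Δ′ (T ∪ ｛ neg (p y) ｝))) →
                  Subsumes Γ (T ∪ Positive p ys) → Derivation F Γ →
                  Extension Γ (length ys * suc c) (λ Δ → Subsumes Δ T)
  resolve-along p [] _ clause d = stay d (Subsumes-weaken [ id , (λ { (_ , () , _) }) ] clause)
  resolve-along p {T} {c = c} (y ∷ ys) step clause d =
    weaken-bound (≤-reflexive (+-suc c _)) (
      step (here refl) ⊑-refl d >>= λ Γ⊑Δ dΔ negated →
      resolve-step (p y) cut (Subsumes-mono Γ⊑Δ clause) negated dΔ >>= λ Δ⊑Δ′ dΔ′ clause′ →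
      resolve-along p ys (λ y∈ys Δ′⊑Δ″ → step (there y∈ys) (⊑-trans (⊑-trans Γ⊑Δ Δ⊑Δ′) Δ′⊑Δ″))
        clause′ dΔ′)
    where
    cut : ((T ∪ Positive p (y ∷ ys)) ∖ ｛ pos (p y) ｝) ∪ ((T ∪ ｛ neg (p y) ｝) ∖ ｛ neg (p y) ｝)
          ⊆ T ∪ Positive p ys
    cut (inj₁ (inj₁ t , _))                        = inj₁ t
    cut (inj₁ (inj₂ (_ , here refl , refl) , ne))  = ⊥-elim (ne refl)
    cut (inj₁ (inj₂ (z , there z∈ys , e) , _))     = inj₂ (z , z∈ys , e)
    cut (inj₂ (inj₁ t , _))                        = inj₁ t
    cut (inj₂ (inj₂ e , ne))                       = ⊥-elim (ne e)

  eliminate-variables : ∀ {k Γ} (w : Fin k → V) {S : LiteralSet} →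
              (∀ ρ → Subsumes F (S ∪ Falsified w ρ)) →
              Derivation F Γ → Extension Γ (treeSize k) (λ Δ → Subsumes Δ S)
  eliminate-variables {zero} w leaf d with leaf []
  ... | C , C∈F , C⊆ =
    map-property (λ _ → Subsumes-weaken ([ id , (λ ()) ] ∘ C⊆)) (axiom-step C∈F d)
  eliminate-variables {suc k} w {S} leaf d =
    eliminate-variables (w ∘ Fin.suc) (restrict false) d >>= λ Γ⊑Δ dΔ clause₀ →
    eliminate-variables (w ∘ Fin.suc) (restrict true) dΔ >>= λ Δ⊑Δ′ dΔ′ clause₁ →
    resolve-step (w Fin.zero) [ drop false , drop true ] (Subsumes-mono Δ⊑Δ′ clause₀) clause₁ dΔ′
    where
    restrict : ∀ b ρ → Subsumes F ((S ∪ ｛ falsified b (w Fin.zero) ｝) ∪ Falsified (w ∘ Fin.suc) ρ)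
    restrict b ρ = Subsumes-weaken assocˡ (leaf (b ∷ ρ))
    drop : ∀ b → (S ∪ ｛ falsified b (w Fin.zero) ｝) ∖ ｛ falsified b (w Fin.zero) ｝ ⊆ S
    drop b (inj₁ s , _)  = s
    drop b (inj₂ e , ne) = ⊥-elim (ne e)

  module OrderingPrinciple {X : Set} (_≺_ : X → X → V)
    (irreflexivity : ∀ x → (neg (x ≺ x) ∷ []) ∈ F)
    (transitivity : ∀ x y z → (neg (x ≺ y) ∷ neg (y ≺ z) ∷ pos (x ≺ z) ∷ []) ∈ F) where

    SuccessorIn : X → List X → LiteralSet
    SuccessorIn x = Positive (x ≺_)

    NoMaximum : List X → List (Clause V) → Set
    NoMaximum S Γ = ∀ {x} → x ∈ S → Subsumes Γ (SuccessorIn x S)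

    reroute-via : ∀ {Γ x K S y} → y ∈ S → Subsumes Γ (SuccessorIn x (K ∷ S)) → Derivation F Γ →
              Extension Γ 2 (λ Δ → Subsumes Δ (SuccessorIn x S ∪ ｛ neg (K ≺ y) ｝))
    reroute-via {x = x} {K} {S} {y} y∈S succ d =
      axiom-step (transitivity x K y) d >>= λ Γ⊑Δ dΔ trans-xKy →
      resolve-step (x ≺ K) cut (Subsumes-mono Γ⊑Δ succ) trans-xKy dΔ
      where
      cut : (SuccessorIn x (K ∷ S) ∖ ｛ pos (x ≺ K) ｝)
              ∪ ((_∈ neg (x ≺ K) ∷ neg (K ≺ y) ∷ pos (x ≺ y) ∷ []) ∖ ｛ neg (x ≺ K) ｝)
            ⊆ SuccessorIn x S ∪ ｛ neg (K ≺ y) ｝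
      cut (inj₁ ((_ , here refl , refl) , ne))  = ⊥-elim (ne refl)
      cut (inj₁ ((z , there z∈S , e) , _))      = inj₁ (z , z∈S , e)
      cut (inj₂ (here refl , ne))               = ⊥-elim (ne refl)
      cut (inj₂ (there (here refl) , _))        = inj₂ refl
      cut (inj₂ (there (there (here refl)) , _)) = inj₁ (y , y∈S , refl)

    reroute : ∀ {Γ x K S} → Subsumes Γ (SuccessorIn x (K ∷ S)) → Subsumes Γ (SuccessorIn K S) →
             Derivation F Γ → Extension Γ (length S * 3) (λ Δ → Subsumes Δ (SuccessorIn x S))
    reroute {S = S} succ-x succ-K =
      resolve-along (_ ≺_) S (λ y∈S Γ⊑Δ → reroute-via y∈S (Subsumes-mono Γ⊑Δ succ-x))
        (Subsumes-weaken inj₂ succ-K)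

    remove : ∀ {Γ K S} → NoMaximum (K ∷ S) Γ → Derivation F Γ →
             Extension Γ (removalCost (length S))
                         (λ Δ → Subsumes Δ (SuccessorIn K S) × NoMaximum S Δ)
    remove {K = K} {S} noMax d =
      axiom-step (irreflexivity K) d >>= λ Γ⊑Δ₁ d₁ irrefl-K →
      resolve-step (K ≺ K) cut (Subsumes-mono Γ⊑Δ₁ (noMax (here refl))) irrefl-K d₁
        >>= λ Δ₁⊑Δ₂ d₂ succ-K →
      map-property {P = NoMaximum S} (λ Δ₂⊑Δ₃ noMax′ → Subsumes-mono Δ₂⊑Δ₃ succ-K , noMax′)
        (forEach Subsumes-mono S
          (λ x∈S Δ₂⊑Δ →
             reroute (Subsumes-mono (⊑-trans (⊑-trans Γ⊑Δ₁ Δ₁⊑Δ₂) Δ₂⊑Δ) (noMax (there x∈S)))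
                     (Subsumes-mono Δ₂⊑Δ succ-K))
          d₂)
      where
      cut : (SuccessorIn K (K ∷ S) ∖ ｛ pos (K ≺ K) ｝) ∪ ((_∈ neg (K ≺ K) ∷ []) ∖ ｛ neg (K ≺ K) ｝)
            ⊆ SuccessorIn K S
      cut (inj₁ ((_ , here refl , refl) , ne)) = ⊥-elim (ne refl)
      cut (inj₁ ((y , there y∈S , e) , _))     = y , y∈S , e
      cut (inj₂ (here refl , ne))              = ⊥-elim (ne refl)

    refute : ∀ {Γ x} S → x ∈ S → NoMaximum S Γ → Derivation F Γ →
             Extension Γ (refutationCost (length S)) (λ Δ → [] ∈ Δ)
    refute (K ∷ []) _ noMax d =
      weaken-bound (m≤m+n _ 0)
        (map-property (λ _ → empty-clause ∘ Subsumes-weaken (λ { (_ , () , _) }) ∘ proj₁)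
                      (remove noMax d))
    refute (K ∷ K′ ∷ S) _ noMax d =
      remove noMax d >>= λ _ d′ (_ , noMax′) → refute (K′ ∷ S) (here refl) noMax′ d′

fromBits : ∀ {m} → Vec Bool m → ℕ
fromBits []          = 0
fromBits (false ∷ ρ) = fromBits ρ * 2
fromBits (true ∷ ρ)  = 1 + fromBits ρ * 2

double-< : ∀ {k n} → k < n → suc k * 2 ≤ 2 * n
double-< {n = n} k<n = ≤-trans (*-monoˡ-≤ 2 k<n) (≤-reflexive (*-comm n 2))

fromBits-< : ∀ {m} (ρ : Vec Bool m) → fromBits ρ < 2 ^ m
fromBits-< []          = s≤s z≤n
fromBits-< (false ∷ ρ) = ≤-trans (n≤1+n _) (double-< (fromBits-< ρ))
fromBits-< (true ∷ ρ)  = double-< (fromBits-< ρ)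

fromBits-%2 : ∀ {m} b (ρ : Vec Bool m) → (fromBits (b ∷ ρ) % 2 ≡ᵇ 1) ≡ b
fromBits-%2 false ρ = cong (_≡ᵇ 1) (m*n%n≡0 (fromBits ρ) 2)
fromBits-%2 true  ρ = cong (_≡ᵇ 1) ([m+kn]%n≡m%n 1 (fromBits ρ) 2)

fromBits-/2 : ∀ {m} b (ρ : Vec Bool m) → fromBits (b ∷ ρ) / 2 ≡ fromBits ρ
fromBits-/2 false ρ = m*n/n≡m (fromBits ρ) 2
fromBits-/2 true  ρ =
  trans (+-distrib-/-∣ʳ 1 {d = 2} (divides-refl (fromBits ρ))) (m*n/n≡m (fromBits ρ) 2)

bits-fromBits : ∀ {m} (ρ : Vec Bool m) → bits m (fromBits ρ) ≡ ρ
bits-fromBits []      = refl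
bits-fromBits (b ∷ ρ) =
  cong₂ _∷_ (fromBits-%2 b ρ) (trans (cong (bits _) (fromBits-/2 b ρ)) (bits-fromBits ρ))

binOPVar-≟ : ∀ {m} → DecidableEquality (BinOPVar m)
binOPVar-≟ (ν x y) (ν x′ y′) =
  map′ (uncurry (cong₂ ν)) (λ { refl → refl , refl }) (x Fin.≟ x′ ×-dec y Fin.≟ y′)
binOPVar-≟ (ω x i) (ω x′ i′) =
  map′ (uncurry (cong₂ ω)) (λ { refl → refl , refl }) (x Fin.≟ x′ ×-dec i Fin.≟ i′)
binOPVar-≟ (ν _ _) (ω _ _) = no λ ()
binOPVar-≟ (ω _ _) (ν _ _) = no λ ()

ωlit-falsified : ∀ {m} (x : Fin (2 ^ m)) (i : Fin m) b → ωlit x i b ≡ falsified b (ω x i)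
ωlit-falsified x i true  = refl
ωlit-falsified x i false = refl

∈-concatMap-allFin : ∀ {A : Set} {n} (f : Fin n → List A) {y} x →
                     y ∈ f x → y ∈ concatMap f (allFin n)
∈-concatMap-allFin f x = ∈-concatMap⁺ f ∘ lose (∈-allFin x)

module BinOPRefutation (m : ℕ) where

  open Resolution binOPVar-≟ (BinOP m)

  N : ℕ
  N = 2 ^ m

  X : List (Fin N)
  X = allFin N

  rowAxiom : Fin N → Fin N → Clause (BinOPVar m)
  rowAxiom x a = map (λ i → ωlit x i (lookup (bits m (toℕ a)) i)) (allFin m) ++ (pos (ν x a) ∷ [])

  transitivityClause : Fin N → Fin N → Fin N → Clause (BinOPVar m)
  transitivityClause x y z = neg (ν x y) ∷ neg (ν y z) ∷ pos (ν x z) ∷ []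

  irreflexivityClause : Fin N → Clause (BinOPVar m)
  irreflexivityClause x = neg (ν x x) ∷ []

  transitivityClauses : List (Clause (BinOPVar m))
  transitivityClauses = concatMap (λ x → concatMap (λ y → map (transitivityClause x y) X) X) X

  irreflexivity∈ : ∀ x → irreflexivityClause x ∈ BinOP m
  irreflexivity∈ x = ∈-++⁺ˡ (∈-map⁺ irreflexivityClause (∈-allFin x))

  transitivity∈ : ∀ x y z → transitivityClause x y z ∈ BinOP m
  transitivity∈ x y z =
    ∈-++⁺ʳ (map irreflexivityClause X) (∈-++⁺ˡ
      (∈-concatMap-allFin (λ x → concatMap (λ y → map (transitivityClause x y) X) X) x
        (∈-concatMap-allFin (λ y → map (transitivityClause x y) X) y
          (∈-map⁺ (transitivityClause x y) (∈-allFin z)))))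

  rowAxiom∈ : ∀ x a → rowAxiom x a ∈ BinOP m
  rowAxiom∈ x a =
    ∈-++⁺ʳ (map irreflexivityClause X) (∈-++⁺ʳ transitivityClauses
      (∈-concatMap-allFin (λ x → map (rowAxiom x) X) x (∈-map⁺ (rowAxiom x) (∈-allFin a))))

  open OrderingPrinciple ν irreflexivity∈ transitivity∈

  rowAxiom-subsumes : ∀ x ρ → Subsumes (BinOP m) (SuccessorIn x X ∪ Falsified (ω x) ρ)
  rowAxiom-subsumes x ρ = rowAxiom x a , rowAxiom∈ x a , literals
    where
    a : Fin N
    a = fromℕ< (fromBits-< ρ)
    bits-a : bits m (toℕ a) ≡ ρ
    bits-a = trans (cong (bits m) (toℕ-fromℕ< (fromBits-< ρ))) (bits-fromBits ρ)
    literals : (_∈ rowAxiom x a) ⊆ SuccessorIn x X ∪ Falsified (ω x) ρ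
    literals l∈ with ∈-++⁻ (map (λ i → ωlit x i (lookup (bits m (toℕ a)) i)) (allFin m)) l∈
    ... | inj₂ (here refl) = inj₁ (a , ∈-allFin a , refl)
    ... | inj₁ l∈ω with ∈-map⁻ (λ i → ωlit x i (lookup (bits m (toℕ a)) i)) l∈ω
    ...   | i , _ , refl rewrite bits-a | ωlit-falsified x i (lookup ρ i) =
      inj₂ (Falsified-lookup (ω x) ρ i)

  refutation : Extension [] (length X * treeSize m + refutationCost (length X)) (λ Δ → [] ∈ Δ)
  refutation =
    forEach {P = λ x Δ → Subsumes Δ (SuccessorIn x X)} Subsumes-mono X
      (λ {x} _ _ → eliminate-variables (ω x) (rowAxiom-subsumes x)) [] >>= λ _ d noMax →
    refute X (∈-allFin (fromℕ< (m^n>0 2 m))) noMax d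

  refutation-size : length X * treeSize m + refutationCost (length X) ≤ 7 * N ^ 3
  refutation-size = begin
    length X * treeSize m + refutationCost (length X)
      ≡⟨ cong (λ k → k * treeSize m + refutationCost k) (length-tabulate (id {A = Fin N})) ⟩
    N * treeSize m + refutationCost N
      ≤⟨ +-mono-≤ (*-monoʳ-≤ N (≤-trans (n≤1+n _) (≤-reflexive (suc-treeSize m))))
                  (refutationCost-≤ N) ⟩
    N * (2 * N) + N * removalCost N
      ≤⟨ cubic-bound N (m^n>0 2 m) ⟩
    7 * N ^ 3 ∎
    where open ≤-Reasoning

lemma5p3 : Σ ℕ λ c → Σ ℕ λ k → (m : ℕ) →
    Σ (List (Clause (BinOPVar m))) λ Γ →
      Refutation (BinOP m) Γ × length Γ ≤ c * (2 ^ m) ^ k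
lemma5p3 = 7 , 3 , λ m →
  let open BinOPRefutation m using (refutation; refutation-size)
      open Resolution.Extension refutation
  in Δ , (derivation , holds) , ≤-trans bounded refutation-size
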